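{- Let $n,d$ be nonnegative integers and suppose $k\in\mathbb{N}$ with $k\ge c(Q_n)$ satisfies $k<\frac{2^n}{\sum_{i=0}^d\binom{n}{i}}$. Then $\mathrm{capt}_k(Q_n)>d$. In particular, this lower bound holds provided $k<\frac12\cdot 2^n\left(\frac{d}{en}\right)^d$ for some $d\le n/3$.
   Context: $Q_n$ is the $n$-dimensional hypercube on $2^n$ vertices, viewed as a reflexive graph, with cop number $c(Q_n)$. The game of Cops and Robbers: cops choose starting vertices (round 0), then the robber; players alternate, cops (any subset) moving to adjacent vertices or staying put, then the robber moving or staying; cops win by occupying the robber's vertex. For $k\ge c(G)$, $\mathrm{capt}_k(G)$ is the minimum over $k$-cop strategies of the number of rounds (excluding round 0) until capture against an optimally evading robber. -}

module Defs where

open import Data.Nat using (ℕ; zero; suc; _+_; _*_; _≡ᵇ_; _<_; _≤_; _!)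
open import Data.Nat.Properties using (_!≢0; m*n≢0)
open import Data.Nat.Combinatorics using (_C_)
open import Data.Bool using (Bool; true; false; if_then_else_; _xor_)
open import Data.Vec using (Vec; []; _∷_)
open import Data.Fin using (Fin)
open import Data.Integer using (+_)
open import Data.Product using (Σ; ∃; ∃-syntax; _×_)
open import Data.Sum using (_⊎_)
open import Relation.Nullary using (¬_)
open import Relation.Binary.PropositionalEquality using (_≡_)
import Data.Rational as ℚ
open ℚ using (ℚ)

record Graph : Set₁ where
  field
    V   : Set
    Adj : V → V → Set

open Graph public

Move : (G : Graph) → V G → V G → Set
Move G u v = (u ≡ v) ⊎ Adj G u v

hamming : ∀ {n} → Vec Bool n → Vec Bool n → ℕ
hamming []       []       = 0
hamming (x ∷ xs) (y ∷ ys) = (if (x xor y) then 1 else 0) + hamming xs ys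

Q : ℕ → Graph
Q n = record { V = Vec Bool n ; Adj = λ u v → hamming u v ≡ 1 }

Cops : ℕ → Graph → Set
Cops k G = Fin k → V G

CopsMove : ∀ {k} (G : Graph) → Cops k G → Cops k G → Set
CopsMove G cs cs′ = ∀ i → Move G (cs i) (cs′ i)

Caught : ∀ {k} (G : Graph) → Cops k G → V G → Set
Caught G cs r = ∃[ i ] (cs i ≡ r)

-- WinWithin G t cs r : in the position where the cops are on cs, the robber
-- on r and the cops are to move, the cops can force capture within at
-- most t further rounds (a round = a cop move followed by a robber move).
data WinWithin {k : ℕ} (G : Graph) : ℕ → Cops k G → V G → Set where
  caught : ∀ {t cs r} → Caught G cs r → WinWithin G t cs r
  step   : ∀ {t cs r} (cs′ : Cops k G) → CopsMove G cs cs′ →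
           (Caught G cs′ r ⊎ (∀ r' → Move G r r' → WinWithin G t cs′ r')) →
           WinWithin G (suc t) cs r

-- k cops can capture the robber within t rounds (round 0 = placement,
-- not counted): there is an initial placement such that for every
-- initial robber vertex the cops force capture within t rounds.
CaptWithin : ℕ → Graph → ℕ → Set
CaptWithin k G t = ∃[ cs₀ ] (∀ (r₀ : V G) → WinWithin {k} G t cs₀ r₀)

CopWin : ℕ → Graph → Set
CopWin k G = ∃[ t ] CaptWithin k G t

IsCopNumber : Graph → ℕ → Set
IsCopNumber G c = CopWin c G × (∀ j → j < c → ¬ CopWin j G)

IsCaptTime : ℕ → Graph → ℕ → Set
IsCaptTime k G t = CaptWithin k G t × (∀ s → s < t → ¬ CaptWithin k G s)

binomSum : ℕ → ℕ → ℕ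
binomSum n zero    = n C 0
binomSum n (suc d) = binomSum n d + n C (suc d)

powℚ : ℚ → ℕ → ℚ
powℚ q zero    = ℚ.1ℚ
powℚ q (suc m) = q ℚ.* powℚ q m

eSum : ℕ → ℚ
eSum zero    = ℚ._/_ (+ 1) (0 !) {{0 !≢0}}
eSum (suc N) = eSum N ℚ.+ ℚ._/_ (+ 1) (suc N !) {{suc N !≢0}}

-- eUpper N = eSum N + 1/(N!·N)  (for N ≥ 1); these rationals are strictly
-- greater than e and decrease to e.
eUpper : ℕ → ℚ
eUpper N = eSum (suc N) ℚ.+ ℚ._/_ (+ 1) (suc N ! * suc N) {{m*n≢0 (suc N !) (suc N) {{suc N !≢0}}}}

-- e < q  (e = Σ 1/i!), for a rational q: since eUpper N > e and
-- eUpper N → e, we have e < q iff eUpper N ≤ q for some N.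
e<_ : ℚ → Set
e< q = ∃[ N ] (eUpper N ℚ.≤ q)

ℕ→ℚ : ℕ → ℚ
ℕ→ℚ m = ℚ._/_ (+ m) 1

-- A cop strategy capturing within t rounds must place some cop within distance t of every vertex:
-- the robber may start anywhere and stand still, and each round moves a cop by at most one step.
-- So k Hamming balls of radius t cover Q_n, and 2^n ≤ k · Σ_{i≤t} C(n,i). Covering is refuted by
-- induction on n: splitting Q_{n+1} by the first coordinate, a ball of radius r leaves traces of radii
-- r and r - 1 on the two halves, so volumes add up by Pascal's rule and one half is undercovered.
-- For the second bound, Σ_{i≤d} C(n,i) ≤ 2·C(n,d) ≤ 2n^d/d! when 3d ≤ n, since consecutive
-- coefficients at least double, and d^d/d! = ∏_{m<d} (1 + 1/m)^m ≤ q^d because the binomial theorem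
-- gives (1 + 1/m)^m ≤ Σ_{i≤m} 1/i!, which lies below every upper approximation of e.

module Submission where

open import Defs
open import Data.Bool using (Bool; true; false; _xor_; if_then_else_)
open import Data.Empty using (⊥-elim)
open import Data.Fin using (Fin; toℕ)
open import Data.Fin.Properties using (toℕ<n)
open import Data.Integer as ℤ using (-[1+_])
open import Data.Integer.Properties using (pos-*; pos-+; drop‿+≤+; drop‿+<+)
open import Data.List using (List; []; _∷_; map; tabulate)
open import Data.List.Relation.Unary.All using (All; []; _∷_)
open import Data.List.Relation.Unary.All.Properties using (tabulate⁻)
open import Data.Nat
  using (ℕ; zero; suc; _+_; _*_; _^_; _∸_; _!; _<_; _≤_; _≤′_; ≤′-reflexive; ≤′-step; z≤n; s≤s; _<?_; pred; NonZero; >-nonZero)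
import Data.Nat.ListAction as List
open import Data.Nat.Combinatorics using (_C_; nCk+nC[k+1]≡[n+1]C[k+1])
open import Data.Nat.Properties
open import Data.Nat.Tactic.RingSolver using (solve-∀)
open import Data.Product using (_×_; _,_; ∃-syntax; proj₁; proj₂)
import Data.Rational as ℚ
open ℚ using (mkℚ; toℚᵘ)
import Data.Rational.Properties as ℚ
import Data.Rational.Unnormalised as ℚᵘ
open ℚᵘ using (ℚᵘ; mkℚᵘ; *≡*; *≤*; *<*)
import Data.Rational.Unnormalised.Properties as ℚᵘ
open import Data.Sum using (_⊎_; inj₁; inj₂; [_,_]′)
open import Data.Vec using (Vec; []; _∷_)
open import Function using (_∘_)
open import Relation.Binary.PropositionalEquality
open import Relation.Nullary using (¬_; yes; no)
open import Algebra.Properties.CommutativeSemigroup +-commutativeSemigroup using (interchange)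
open import Algebra.Properties.CommutativeSemigroup *-commutativeSemigroup using (x∙yz≈y∙xz; xy∙z≈xz∙y)
open import Algebra.Properties.CommutativeSemiring.Binomial +-*-commutativeSemiring using (theorem; binomialTerm)
open import Algebra.Properties.Semiring.Exp +-*-semiring using () renaming (_^_ to _^ˢ_)
open import Algebra.Properties.Semiring.Mult +-*-semiring using () renaming (_×_ to _×ˢ_)
open import Algebra.Properties.Semiring.Sum +-*-semiring using (sum; *-distribˡ-sum; *-distribʳ-sum)

-- Distance in the hypercube and the game

hamming-refl : ∀ {n} (u : Vec Bool n) → hamming u u ≡ 0
hamming-refl []          = refl
hamming-refl (true  ∷ u) = hamming-refl u
hamming-refl (false ∷ u) = hamming-refl u

hamming-triangle : ∀ {n} (u v w : Vec Bool n) → hamming u w ≤ hamming u v + hamming v w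
hamming-triangle [] [] [] = z≤n
hamming-triangle (x ∷ u) (y ∷ v) (z ∷ w) = begin
  δ x z + hamming u w                            ≤⟨ +-mono-≤ (xor-triangle x y z) (hamming-triangle u v w) ⟩
  (δ x y + δ y z) + (hamming u v + hamming v w)  ≡⟨ interchange (δ x y) (δ y z) (hamming u v) (hamming v w) ⟩
  (δ x y + hamming u v) + (δ y z + hamming v w)  ∎
  where
  open ≤-Reasoning
  δ : Bool → Bool → ℕ
  δ x y = if x xor y then 1 else 0
  xor-triangle : ∀ x y z → δ x z ≤ δ x y + δ y z
  xor-triangle true  true  true  = z≤n
  xor-triangle true  true  false = s≤s z≤n
  xor-triangle true  false true  = z≤n
  xor-triangle true  false false = s≤s z≤n
  xor-triangle false true  true  = s≤s z≤n
  xor-triangle false true  false = z≤n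
  xor-triangle false false true  = s≤s z≤n
  xor-triangle false false false = z≤n

Move⇒hamming≤1 : ∀ {n} {u v : Vec Bool n} → Move (Q n) u v → hamming u v ≤ 1
Move⇒hamming≤1 {u = u} (inj₁ refl) = ≤-trans (≤-reflexive (hamming-refl u)) z≤n
Move⇒hamming≤1         (inj₂ adj)  = ≤-reflexive adj

Caught⇒hamming≤ : ∀ {n k t} {cs : Cops k (Q n)} {r} → Caught (Q n) cs r → ∃[ i ] hamming (cs i) r ≤ t
Caught⇒hamming≤ {r = r} (i , refl) = i , ≤-trans (≤-reflexive (hamming-refl r)) z≤n

WinWithin⇒nearby-cop : ∀ {n k t} {cs : Cops k (Q n)} {r} → WinWithin (Q n) t cs r → ∃[ i ] hamming (cs i) r ≤ t
WinWithin⇒nearby-cop (caught c) = Caught⇒hamming≤ c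
WinWithin⇒nearby-cop {n} {k} {suc t} {cs} {r} (step cs′ moves next) = closer (afterMove next)
  where
  afterMove : Caught (Q n) cs′ r ⊎ (∀ r′ → Move (Q n) r r′ → WinWithin (Q n) t cs′ r′) →
              ∃[ i ] hamming (cs′ i) r ≤ t
  afterMove (inj₁ c)       = Caught⇒hamming≤ c
  afterMove (inj₂ respond) = WinWithin⇒nearby-cop (respond r (inj₁ refl))
  closer : ∃[ i ] hamming (cs′ i) r ≤ t → ∃[ i ] hamming (cs i) r ≤ suc t
  closer (i , near) = i , ≤-trans (hamming-triangle (cs i) (cs′ i) r) (+-mono-≤ (Move⇒hamming≤1 (moves i)) near)

-- Balls in the hypercube

binomSum-0 : ∀ r → binomSum 0 r ≡ 1
binomSum-0 zero    = refl
binomSum-0 (suc r) = trans (+-identityʳ _) (binomSum-0 r)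

binomSum-pascal : ∀ n r → binomSum (suc n) (suc r) ≡ binomSum n (suc r) + binomSum n r
binomSum-pascal n zero = begin
  1 + suc n C 1    ≡⟨ cong (1 +_) (sym (nCk+nC[k+1]≡[n+1]C[k+1] n 0)) ⟩
  1 + (1 + n C 1)  ≡⟨ +-comm 1 (1 + n C 1) ⟩
  (1 + n C 1) + 1  ∎
  where open ≡-Reasoning
binomSum-pascal n (suc r) = begin
  binomSum (suc n) (suc r) + suc n C suc (suc r)
    ≡⟨ cong₂ _+_ (binomSum-pascal n r) (trans (sym (nCk+nC[k+1]≡[n+1]C[k+1] n (suc r))) (+-comm (n C suc r) _)) ⟩
  (binomSum n (suc r) + binomSum n r) + (n C suc (suc r) + n C suc r)
    ≡⟨ interchange (binomSum n (suc r)) (binomSum n r) (n C suc (suc r)) (n C suc r) ⟩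
  (binomSum n (suc r) + n C suc (suc r)) + (binomSum n r + n C suc r) ∎
  where open ≡-Reasoning

Ball : ℕ → Set
Ball n = Vec Bool n × ℕ

Outside : ∀ {n} → Vec Bool n → Ball n → Set
Outside v (c , r) = r < hamming c v

volume : ∀ {n} → List (Ball n) → ℕ
volume {n} = List.sum ∘ map (binomSum n ∘ proj₂)

-- trace b c r : the trace of a ball of radius r on a subcube containing its centre (b = false) or
-- adjacent to it (b = true), the centre c being the projection of the original one.
trace : ∀ {n} → Bool → Vec Bool n → ℕ → List (Ball n) → List (Ball n)
trace false c r       balls = (c , r) ∷ balls
trace true  c zero    balls = balls
trace true  c (suc r) balls = (c , r) ∷ balls

restrict : ∀ {n} → Bool → List (Ball (suc n)) → List (Ball n)
restrict y []                     = []
restrict y ((x ∷ c , r) ∷ balls) = trace (x xor y) c r (restrict y balls)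

outside-trace : ∀ {n} (v : Vec Bool n) b c r balls → All (Outside v) (trace b c r balls) →
                r < (if b then 1 else 0) + hamming c v × All (Outside v) balls
outside-trace v false c r       balls (out ∷ outs) = out , outs
outside-trace v true  c zero    balls outs         = s≤s z≤n , outs
outside-trace v true  c (suc r) balls (out ∷ outs) = s≤s out , outs

outside-restrict : ∀ {n} y (v : Vec Bool n) balls → All (Outside v) (restrict y balls) → All (Outside (y ∷ v)) balls
outside-restrict y v []                    outs = []
outside-restrict y v ((x ∷ c , r) ∷ balls) outs with outside-trace v (x xor y) c r (restrict y balls) outs
... | out , outs′ = out ∷ outside-restrict y v balls outs′

volume-restrict : ∀ {n} (balls : List (Ball (suc n))) →
                  volume (restrict false balls) + volume (restrict true balls) ≡ volume balls
volume-restrict [] = refl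
volume-restrict {n} ((x ∷ c , r) ∷ balls) = trans (split x r) (cong (binomSum (suc n) r +_) (volume-restrict balls))
  where
  V₀ = volume (restrict false balls)
  V₁ = volume (restrict true balls)
  split : ∀ x r → volume (trace (x xor false) c r (restrict false balls)) + volume (trace (x xor true) c r (restrict true balls))
                  ≡ binomSum (suc n) r + (V₀ + V₁)
  split false zero    = +-assoc 1 V₀ V₁
  split true  zero    = +-suc V₀ V₁
  split false (suc r) = trans (interchange (binomSum n (suc r)) V₀ (binomSum n r) V₁)
                              (cong (_+ (V₀ + V₁)) (sym (binomSum-pascal n r)))
  split true  (suc r) = trans (interchange (binomSum n r) V₀ (binomSum n (suc r)) V₁)
                              (cong (_+ (V₀ + V₁)) (trans (+-comm (binomSum n r) _) (sym (binomSum-pascal n r))))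

m+n<o+o⇒m<o⊎n<o : ∀ {m n o} → m + n < o + o → m < o ⊎ n < o
m+n<o+o⇒m<o⊎n<o {m} {n} {o} m+n<o+o with m <? o
... | yes m<o = inj₁ m<o
... | no  m≮o = inj₂ (+-cancelˡ-< o n o (≤-<-trans (+-monoˡ-≤ n (≮⇒≥ m≮o)) m+n<o+o))

∃-outside-balls : ∀ n (balls : List (Ball n)) → volume balls < 2 ^ n → ∃[ v ] All (Outside v) balls
∃-outside-balls zero [] _ = [] , []
∃-outside-balls zero ((c , r) ∷ balls) small =
  ⊥-elim (<⇒≱ small (≤-trans (≤-reflexive (sym (binomSum-0 r))) (m≤m+n _ _)))
∃-outside-balls (suc n) balls small = [ extend false , extend true ]′ (m+n<o+o⇒m<o⊎n<o halves)
  where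
  halves : volume (restrict false balls) + volume (restrict true balls) < 2 ^ n + 2 ^ n
  halves = subst₂ _<_ (sym (volume-restrict balls)) (cong (2 ^ n +_) (+-identityʳ (2 ^ n))) small
  extend : ∀ y → volume (restrict y balls) < 2 ^ n → ∃[ v ] All (Outside v) balls
  extend y small′ = let v , outs = ∃-outside-balls n (restrict y balls) small′ in y ∷ v , outside-restrict y v balls outs

copBalls : ∀ {n k} → Cops k (Q n) → ℕ → List (Ball n)
copBalls cs r = tabulate (λ i → cs i , r)

volume-copBalls : ∀ {n} k (cs : Cops k (Q n)) r → volume (copBalls cs r) ≡ k * binomSum n r
volume-copBalls zero    cs r = refl
volume-copBalls (suc k) cs r = cong (binomSum _ r +_) (volume-copBalls k (cs ∘ Fin.suc) r)

captWithin-lower-bound : ∀ {n d k t} → k * binomSum n d < 2 ^ n → CaptWithin k (Q n) t → d < t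
captWithin-lower-bound {n} {d} {k} small (cs₀ , wins) = ≰⇒> λ t≤d →
  let v , outs  = ∃-outside-balls n (copBalls cs₀ d) (subst (_< 2 ^ n) (sym (volume-copBalls k cs₀ d)) small)
      i , close = WinWithin⇒nearby-cop (wins v)
  in <⇒≱ (tabulate⁻ outs i) (≤-trans close t≤d)

-- Binomial coefficients and falling factorials

infix 8 _↓_

_↓_ : ℕ → ℕ → ℕ
n     ↓ zero  = 1
zero  ↓ suc k = 0
suc n ↓ suc k = suc n * n ↓ k

-- n ↓ (k + 1) = (n - k) · n ↓ k, stated without truncated subtraction
↓-suc : ∀ n k → suc k * n ↓ k + n ↓ suc k ≡ suc n * n ↓ k
↓-suc zero    zero    = refl
↓-suc zero    (suc k) = trans (+-identityʳ _) (*-zeroʳ (suc (suc k)))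
↓-suc (suc n) zero    = refl
↓-suc (suc n) (suc k) = begin
  suc (suc k) * (suc n * n ↓ k) + suc n * n ↓ suc k  ≡⟨ lemma (suc k) (suc n) (n ↓ k) (n ↓ suc k) ⟩
  suc n * (n ↓ k + (suc k * n ↓ k + n ↓ suc k))      ≡⟨ cong (λ x → suc n * (n ↓ k + x)) (↓-suc n k) ⟩
  suc n * (n ↓ k + suc n * n ↓ k)                    ≡⟨ *-distribˡ-+ (suc n) (n ↓ k) _ ⟩
  suc n * n ↓ k + suc n * (suc n * n ↓ k)            ∎
  where
  open ≡-Reasoning
  lemma : ∀ k n f g → (1 + k) * (n * f) + n * g ≡ n * (f + (k * f + g))
  lemma = solve-∀

nCk*k!≡n↓k : ∀ n k → (n C k) * k ! ≡ n ↓ k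
nCk*k!≡n↓k zero    zero    = refl
nCk*k!≡n↓k zero    (suc k) = refl
nCk*k!≡n↓k (suc n) zero    = refl
nCk*k!≡n↓k (suc n) (suc k) = begin
  (suc n C suc k) * (suc k * k !)                        ≡⟨ cong (_* (suc k * k !)) (sym (nCk+nC[k+1]≡[n+1]C[k+1] n k)) ⟩
  ((n C k) + (n C suc k)) * (suc k * k !)                ≡⟨ lemma (n C k) (n C suc k) (suc k) (k !) ⟩
  suc k * ((n C k) * k !) + (n C suc k) * (suc k * k !)  ≡⟨ cong₂ (λ x y → suc k * x + y) (nCk*k!≡n↓k n k) (nCk*k!≡n↓k n (suc k)) ⟩
  suc k * n ↓ k + n ↓ suc k                              ≡⟨ ↓-suc n k ⟩
  suc n * n ↓ k                                          ∎
  where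
  open ≡-Reasoning
  lemma : ∀ a b k f → (a + b) * (k * f) ≡ k * (a * f) + b * (k * f)
  lemma = solve-∀

n↓k≤n^k : ∀ n k → n ↓ k ≤ n ^ k
n↓k≤n^k n       zero    = ≤-refl
n↓k≤n^k zero    (suc k) = z≤n
n↓k≤n^k (suc n) (suc k) = *-monoʳ-≤ (suc n) (≤-trans (n↓k≤n^k n k) (^-monoˡ-≤ k (n≤1+n n)))

2*nCk≤nC[k+1] : ∀ n k → 3 * suc k ≤ n → 2 * (n C k) ≤ n C suc k
2*nCk≤nC[k+1] n k 3[k+1]≤n = *-cancelʳ-≤ _ _ (suc k !) {{suc k !≢0}} (begin
  2 * (n C k) * suc k !        ≡⟨ lemma (n C k) (suc k) (k !) ⟩
  2 * suc k * ((n C k) * k !)  ≡⟨ cong (2 * suc k *_) (nCk*k!≡n↓k n k) ⟩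
  2 * suc k * n ↓ k            ≤⟨ +-cancelˡ-≤ (suc k * n ↓ k) _ _ ratio ⟩
  n ↓ suc k                    ≡⟨ nCk*k!≡n↓k n (suc k) ⟨
  (n C suc k) * suc k !        ∎)
  where
  open ≤-Reasoning
  lemma : ∀ c k f → 2 * c * (k * f) ≡ 2 * k * (c * f)
  lemma = solve-∀
  triple : ∀ k f → k * f + 2 * k * f ≡ 3 * k * f
  triple = solve-∀
  ratio : suc k * n ↓ k + 2 * suc k * n ↓ k ≤ suc k * n ↓ k + n ↓ suc k
  ratio = begin
    suc k * n ↓ k + 2 * suc k * n ↓ k  ≡⟨ triple (suc k) (n ↓ k) ⟩
    3 * suc k * n ↓ k                  ≤⟨ *-monoˡ-≤ (n ↓ k) (≤-trans 3[k+1]≤n (n≤1+n n)) ⟩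
    suc n * n ↓ k                      ≡⟨ ↓-suc n k ⟨
    suc k * n ↓ k + n ↓ suc k          ∎

binomSum≤2*nCd : ∀ n d → 3 * d ≤ n → binomSum n d ≤ 2 * (n C d)
binomSum≤2*nCd n zero    _      = m≤n*m (n C 0) 2
binomSum≤2*nCd n (suc d) 3d+3≤n = begin
  binomSum n d + (n C suc d)  ≤⟨ +-monoˡ-≤ (n C suc d) (binomSum≤2*nCd n d (≤-trans (*-monoʳ-≤ 3 (n≤1+n d)) 3d+3≤n)) ⟩
  2 * (n C d) + (n C suc d)   ≤⟨ +-monoˡ-≤ (n C suc d) (2*nCk≤nC[k+1] n d 3d+3≤n) ⟩
  (n C suc d) + (n C suc d)   ≡⟨ cong ((n C suc d) +_) (+-identityʳ _) ⟨
  2 * (n C suc d)             ∎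
  where open ≤-Reasoning

binomSum*d!≤2*n^d : ∀ n d → 3 * d ≤ n → binomSum n d * d ! ≤ 2 * n ^ d
binomSum*d!≤2*n^d n d 3d≤n = begin
  binomSum n d * d !   ≤⟨ *-monoˡ-≤ (d !) (binomSum≤2*nCd n d 3d≤n) ⟩
  2 * (n C d) * d !    ≡⟨ *-assoc 2 (n C d) (d !) ⟩
  2 * ((n C d) * d !)  ≡⟨ cong (2 *_) (nCk*k!≡n↓k n d) ⟩
  2 * n ↓ d            ≤⟨ *-monoʳ-≤ 2 (n↓k≤n^k n d) ⟩
  2 * n ^ d            ∎
  where open ≤-Reasoning

-- Estimates for e

sum-mono-≤ : ∀ {n} (f g : Fin n → ℕ) → (∀ i → f i ≤ g i) → sum f ≤ sum g
sum-mono-≤ {zero}  f g f≤g = z≤n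
sum-mono-≤ {suc n} f g f≤g = +-mono-≤ (f≤g _) (sum-mono-≤ (f ∘ Fin.suc) (g ∘ Fin.suc) (f≤g ∘ Fin.suc))

^ˢ≡^ : ∀ x n → x ^ˢ n ≡ x ^ n
^ˢ≡^ x zero    = refl
^ˢ≡^ x (suc n) = cong (x *_) (^ˢ≡^ x n)

×ˢ≡* : ∀ n x → n ×ˢ x ≡ n * x
×ˢ≡* zero    x = refl
×ˢ≡* (suc n) x = cong (x +_) (×ˢ≡* n x)

-- m ! · eSum m, since m ↓ k = m ! / (m - k) !
eNumerator : ℕ → ℕ
eNumerator m = sum {suc m} (λ k → m ↓ toℕ k)

eNumerator-suc : ∀ m → eNumerator (suc m) ≡ 1 + suc m * eNumerator m
eNumerator-suc m = cong (1 +_) (sym (*-distribˡ-sum {suc m} (suc m) (λ k → m ↓ toℕ k)))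

[j+k]!≤k!*[j+k]^j : ∀ j k → (j + k) ! ≤ k ! * (j + k) ^ j
[j+k]!≤k!*[j+k]^j zero    k = ≤-reflexive (sym (*-identityʳ _))
[j+k]!≤k!*[j+k]^j (suc j) k = begin
  suc (j + k) * (j + k) !                ≤⟨ *-monoʳ-≤ (suc (j + k)) ([j+k]!≤k!*[j+k]^j j k) ⟩
  suc (j + k) * (k ! * (j + k) ^ j)      ≤⟨ *-monoʳ-≤ (suc (j + k)) (*-monoʳ-≤ (k !) (^-monoˡ-≤ j (n≤1+n (j + k)))) ⟩
  suc (j + k) * (k ! * suc (j + k) ^ j)  ≡⟨ x∙yz≈y∙xz (suc (j + k)) (k !) _ ⟩
  k ! * (suc (j + k) * suc (j + k) ^ j)  ∎
  where open ≤-Reasoning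

-- C(m,k) / m^(m-k) ≤ 1 / (m-k)!, multiplied by m^m · m!
nCk*m^k*m!≤m^m*m↓k : ∀ m k → k ≤ m → (m C k) * m ^ k * m ! ≤ m ^ m * m ↓ k
nCk*m^k*m!≤m^m*m↓k m k k≤m = begin
  (m C k) * m ^ k * m !                    ≤⟨ *-monoʳ-≤ ((m C k) * m ^ k) m!≤k!*m^[m∸k] ⟩
  (m C k) * m ^ k * (k ! * m ^ (m ∸ k))    ≡⟨ rearrange (m C k) (m ^ k) (k !) (m ^ (m ∸ k)) ⟩
  (m ^ k * m ^ (m ∸ k)) * ((m C k) * k !)  ≡⟨ cong₂ _*_ m^k*m^[m∸k]≡m^m (nCk*k!≡n↓k m k) ⟩
  m ^ m * m ↓ k                            ∎
  where
  open ≤-Reasoning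
  m!≤k!*m^[m∸k] : m ! ≤ k ! * m ^ (m ∸ k)
  m!≤k!*m^[m∸k] = subst (λ x → x ! ≤ k ! * x ^ (m ∸ k)) (m∸n+n≡m k≤m) ([j+k]!≤k!*[j+k]^j (m ∸ k) k)
  m^k*m^[m∸k]≡m^m : m ^ k * m ^ (m ∸ k) ≡ m ^ m
  m^k*m^[m∸k]≡m^m = trans (sym (^-distribˡ-+-* m k (m ∸ k))) (cong (m ^_) (m+[n∸m]≡n k≤m))
  rearrange : ∀ c a f b → c * a * (f * b) ≡ (a * b) * (c * f)
  rearrange = solve-∀

binomialTerm[m+1]^m : ∀ m k → binomialTerm m 1 m k ≡ (m C toℕ k) * m ^ toℕ k
binomialTerm[m+1]^m m k = begin
  (m C i) ×ˢ (m ^ˢ i * 1 ^ˢ (m ∸ i))  ≡⟨ ×ˢ≡* (m C i) _ ⟩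
  (m C i) * (m ^ˢ i * 1 ^ˢ (m ∸ i))   ≡⟨ cong (λ p → (m C i) * (p * 1 ^ˢ (m ∸ i))) (^ˢ≡^ m i) ⟩
  (m C i) * (m ^ i * 1 ^ˢ (m ∸ i))    ≡⟨ cong (λ p → (m C i) * (m ^ i * p)) (trans (^ˢ≡^ 1 (m ∸ i)) (^-zeroˡ (m ∸ i))) ⟩
  (m C i) * (m ^ i * 1)               ≡⟨ cong ((m C i) *_) (*-identityʳ (m ^ i)) ⟩
  (m C i) * m ^ i                     ∎
  where
  open ≡-Reasoning
  i = toℕ k

infix 4 _≤ᶠ_

-- comparison of fractions x / y, meaningful for nonzero denominators
data _≤ᶠ_ : ℕ × ℕ → ℕ × ℕ → Set where
  *≤* : ∀ {x y z w} → x * w ≤ z * y → (x , y) ≤ᶠ (z , w)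

≤ᶠ-refl : ∀ {p} → p ≤ᶠ p
≤ᶠ-refl = *≤* ≤-refl

≤ᶠ-trans : ∀ {p q r} → 0 < proj₂ q → p ≤ᶠ q → q ≤ᶠ r → p ≤ᶠ r
≤ᶠ-trans {x , y} {z , w} {u , v} 0<w (*≤* x/y≤z/w) (*≤* z/w≤u/v) =
  *≤* (*-cancelʳ-≤ (x * v) (u * y) w {{>-nonZero 0<w}} (begin
    x * v * w  ≡⟨ xy∙z≈xz∙y x v w ⟩
    x * w * v  ≤⟨ *-monoˡ-≤ v x/y≤z/w ⟩
    z * y * v  ≡⟨ xy∙z≈xz∙y z y v ⟩
    z * v * y  ≤⟨ *-monoˡ-≤ y z/w≤u/v ⟩
    u * w * y  ≡⟨ xy∙z≈xz∙y u w y ⟩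
    u * y * w  ∎))
  where open ≤-Reasoning

eSumᶠ : ℕ → ℕ × ℕ
eSumᶠ m = eNumerator m , m !

eUpperᶠ : ℕ → ℕ × ℕ
eUpperᶠ N = suc N * eNumerator (suc N) + 1 , suc N ! * suc N

0<eUpperᶠ-denominator : ∀ N → 0 < proj₂ (eUpperᶠ N)
0<eUpperᶠ-denominator N = *-mono-< (1≤n! (suc N)) (s≤s z≤n)

eSumᶠm≤eSumᶠ[1+m] : ∀ m → eSumᶠ m ≤ᶠ eSumᶠ (suc m)
eSumᶠm≤eSumᶠ[1+m] m = *≤* (begin
  eNumerator m * (suc m * m !)        ≤⟨ m≤n+m _ (m !) ⟩
  m ! + eNumerator m * (suc m * m !)  ≡⟨ lemma (eNumerator m) (m !) (suc m) ⟩
  (1 + suc m * eNumerator m) * m !    ≡⟨ cong (_* m !) (eNumerator-suc m) ⟨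
  eNumerator (suc m) * m !            ∎)
  where
  open ≤-Reasoning
  lemma : ∀ a f k → f + a * (k * f) ≡ (1 + k * a) * f
  lemma = solve-∀

eSumᶠ-mono : ∀ {m m′} → m ≤′ m′ → eSumᶠ m ≤ᶠ eSumᶠ m′
eSumᶠ-mono (≤′-reflexive refl) = ≤ᶠ-refl
eSumᶠ-mono {m′ = suc m′} (≤′-step m≤′m′) = ≤ᶠ-trans (1≤n! m′) (eSumᶠ-mono m≤′m′) (eSumᶠm≤eSumᶠ[1+m] m′)

eSumᶠ[1+N]≤eUpperᶠN : ∀ N → eSumᶠ (suc N) ≤ᶠ eUpperᶠ N
eSumᶠ[1+N]≤eUpperᶠN N = *≤* (begin
  eNumerator K * (K ! * K)        ≤⟨ m≤m+n _ (K !) ⟩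
  eNumerator K * (K ! * K) + K !  ≡⟨ lemma (eNumerator K) (K !) K ⟩
  (K * eNumerator K + 1) * K !    ∎)
  where
  K = suc N
  open ≤-Reasoning
  lemma : ∀ a f k → a * (f * k) + f ≡ (k * a + 1) * f
  lemma = solve-∀

eUpperᶠ[1+N]≤eUpperᶠN : ∀ N → eUpperᶠ (suc N) ≤ᶠ eUpperᶠ N
eUpperᶠ[1+N]≤eUpperᶠN N = *≤* (begin
  (suc K * eNumerator (suc K) + 1) * (K ! * K)                ≡⟨ cong (λ a → (suc K * a + 1) * (K ! * K)) (eNumerator-suc K) ⟩
  (suc K * (1 + suc K * eNumerator K) + 1) * (K ! * K)        ≤⟨ m≤m+n _ (K !) ⟩
  (suc K * (1 + suc K * eNumerator K) + 1) * (K ! * K) + K !  ≡⟨ lemma K (eNumerator K) (K !) ⟩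
  (K * eNumerator K + 1) * (suc K ! * suc K)                  ∎)
  where
  K = suc N
  open ≤-Reasoning
  lemma : ∀ k a f → ((1 + k) * (1 + (1 + k) * a) + 1) * (f * k) + f ≡ (k * a + 1) * (((1 + k) * f) * (1 + k))
  lemma = solve-∀

eUpperᶠ-antimono : ∀ {N N′} → N ≤′ N′ → eUpperᶠ N′ ≤ᶠ eUpperᶠ N
eUpperᶠ-antimono (≤′-reflexive refl) = ≤ᶠ-refl
eUpperᶠ-antimono {N′ = suc N′} (≤′-step N≤′N′) =
  ≤ᶠ-trans (0<eUpperᶠ-denominator N′) (eUpperᶠ[1+N]≤eUpperᶠN N′) (eUpperᶠ-antimono N≤′N′)

eSumᶠ≤eUpperᶠ : ∀ M N → eSumᶠ M ≤ᶠ eUpperᶠ N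
eSumᶠ≤eUpperᶠ zero    N =
  ≤ᶠ-trans (1≤n! (suc N)) (eSumᶠ-mono {m′ = suc N} (≤⇒≤′ z≤n)) (eSumᶠ[1+N]≤eUpperᶠN N)
eSumᶠ≤eUpperᶠ (suc M) N with ≤-total M N
... | inj₁ M≤N = ≤ᶠ-trans (1≤n! (suc N)) (eSumᶠ-mono {m′ = suc N} (≤⇒≤′ (s≤s M≤N))) (eSumᶠ[1+N]≤eUpperᶠN N)
... | inj₂ N≤M = ≤ᶠ-trans (0<eUpperᶠ-denominator M) (eSumᶠ[1+N]≤eUpperᶠN M) (eUpperᶠ-antimono (≤⇒≤′ N≤M))

[1+1/m]^m≤ᶠeSumᶠ : ∀ m → (suc m ^ m , m ^ m) ≤ᶠ eSumᶠ m
[1+1/m]^m≤ᶠeSumᶠ m = *≤* (begin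
  suc m ^ m * m !                                 ≡⟨ cong (_* m !) expansion ⟩
  sum (binomialTerm m 1 m) * m !                  ≡⟨ *-distribʳ-sum (m !) (binomialTerm m 1 m) ⟩
  sum {suc m} (λ k → binomialTerm m 1 m k * m !)  ≤⟨ sum-mono-≤ {suc m} _ _ termwise ⟩
  sum {suc m} (λ k → m ^ m * m ↓ toℕ k)           ≡⟨ *-distribˡ-sum {suc m} (m ^ m) (λ k → m ↓ toℕ k) ⟨
  m ^ m * eNumerator m                            ≡⟨ *-comm (m ^ m) _ ⟩
  eNumerator m * m ^ m                            ∎)
  where
  open ≤-Reasoning
  expansion : suc m ^ m ≡ sum (binomialTerm m 1 m)
  expansion = trans (trans (cong (_^ m) (+-comm 1 m)) (sym (^ˢ≡^ (m + 1) m))) (theorem m m 1)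
  termwise : ∀ k → binomialTerm m 1 m k * m ! ≤ m ^ m * m ↓ toℕ k
  termwise k = subst (λ x → x * m ! ≤ m ^ m * m ↓ toℕ k) (sym (binomialTerm[m+1]^m m k))
                     (nCk*m^k*m!≤m^m*m↓k m (toℕ k) (≤-pred (toℕ<n k)))

[1+1/m]^m≤ᶠeUpperᶠ : ∀ m N → (suc m ^ m , m ^ m) ≤ᶠ eUpperᶠ N
[1+1/m]^m≤ᶠeUpperᶠ m N = ≤ᶠ-trans (1≤n! m) ([1+1/m]^m≤ᶠeSumᶠ m) (eSumᶠ≤eUpperᶠ m N)

-- d^d / d! = ∏_{m<d} (1 + 1/m)^m
d^d/d!≤ᶠ[x/b]^d : ∀ {x b} → (∀ m → (suc m ^ m , m ^ m) ≤ᶠ (x , b)) → ∀ d → (d ^ d , d !) ≤ᶠ (x ^ d , b ^ d)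
d^d/d!≤ᶠ[x/b]^d bound zero = ≤ᶠ-refl
d^d/d!≤ᶠ[x/b]^d {x} {b} bound (suc d) with bound d | d^d/d!≤ᶠ[x/b]^d bound d
... | *≤* ratio | *≤* previous = *≤* (begin
  (suc d * suc d ^ d) * (b * b ^ d)  ≡⟨ lemma₁ (suc d) (suc d ^ d) b (b ^ d) ⟩
  suc d * (suc d ^ d * b) * b ^ d    ≤⟨ *-monoˡ-≤ (b ^ d) (*-monoʳ-≤ (suc d) ratio) ⟩
  suc d * (x * d ^ d) * b ^ d        ≡⟨ lemma₂ (suc d) x (d ^ d) (b ^ d) ⟩
  suc d * x * (d ^ d * b ^ d)        ≤⟨ *-monoʳ-≤ (suc d * x) previous ⟩
  suc d * x * (x ^ d * d !)          ≡⟨ lemma₃ (suc d) x (x ^ d) (d !) ⟩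
  (x * x ^ d) * (suc d * d !)        ∎)
  where
  open ≤-Reasoning
  lemma₁ : ∀ s t b c → (s * t) * (b * c) ≡ s * (t * b) * c
  lemma₁ = solve-∀
  lemma₂ : ∀ s x p c → s * (x * p) * c ≡ s * x * (p * c)
  lemma₂ = solve-∀
  lemma₃ : ∀ s x p f → s * x * (p * f) ≡ (x * p) * (s * f)
  lemma₃ = solve-∀

-- From rationals to fractions of naturals

infix 7.5 _/ᵘ_

-- x / y as an unnormalised rational (junk for y = 0)
_/ᵘ_ : ℕ → ℕ → ℚᵘ
x /ᵘ y = mkℚᵘ (ℤ.+ x) (pred y)

toℚᵘ-/ : ∀ x y .{{_ : NonZero y}} → toℚᵘ (ℤ.+ x ℚ./ y) ℚᵘ.≃ x /ᵘ y
toℚᵘ-/ x (suc y) = ℚ.toℚᵘ-fromℚᵘ (x /ᵘ suc y)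

/ᵘ-+ : ∀ x y z w .{{_ : NonZero y}} .{{_ : NonZero w}} → x /ᵘ y ℚᵘ.+ z /ᵘ w ≡ (x * w + z * y) /ᵘ (y * w)
/ᵘ-+ x y@(suc _) z w@(suc _) =
  cong (λ i → mkℚᵘ i (pred (y * w))) (sym (trans (pos-+ (x * w) (z * y)) (cong₂ ℤ._+_ (pos-* x w) (pos-* z y))))

/ᵘ-* : ∀ x y z w .{{_ : NonZero y}} .{{_ : NonZero w}} → x /ᵘ y ℚᵘ.* z /ᵘ w ≡ (x * z) /ᵘ (y * w)
/ᵘ-* x y@(suc _) z w@(suc _) = cong (λ i → mkℚᵘ i (pred (y * w))) (sym (pos-* x z))

/ᵘ-≃ : ∀ x y z w .{{_ : NonZero y}} .{{_ : NonZero w}} → x * w ≡ z * y → x /ᵘ y ℚᵘ.≃ z /ᵘ w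
/ᵘ-≃ x (suc _) z (suc _) eq = *≡* (trans (sym (pos-* x _)) (trans (cong ℤ.+_ eq) (pos-* z _)))

/ᵘ-≤⇒≤ᶠ : ∀ x y z w .{{_ : NonZero y}} .{{_ : NonZero w}} → x /ᵘ y ℚᵘ.≤ z /ᵘ w → (x , y) ≤ᶠ (z , w)
/ᵘ-≤⇒≤ᶠ x (suc _) z (suc _) (*≤* le) = *≤* (drop‿+≤+ (subst₂ ℤ._≤_ (sym (pos-* x _)) (sym (pos-* z _)) le))

/ᵘ-<⇒< : ∀ x y z w .{{_ : NonZero y}} .{{_ : NonZero w}} → x /ᵘ y ℚᵘ.< z /ᵘ w → x * w < z * y
/ᵘ-<⇒< x (suc _) z (suc _) (*<* lt) = drop‿+<+ (subst₂ ℤ._<_ (sym (pos-* x _)) (sym (pos-* z _)) lt)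

toℚᵘ-eSum : ∀ m → toℚᵘ (eSum m) ℚᵘ.≃ eNumerator m /ᵘ m !
toℚᵘ-eSum zero    = toℚᵘ-/ 1 1
toℚᵘ-eSum (suc m) = begin
  toℚᵘ (eSum (suc m))                                    ≈⟨ ℚ.toℚᵘ-homo-+ (eSum m) _ ⟩
  toℚᵘ (eSum m) ℚᵘ.+ toℚᵘ (ℤ.+ 1 ℚ./ suc m !)            ≈⟨ ℚᵘ.+-cong (toℚᵘ-eSum m) (toℚᵘ-/ 1 (suc m !)) ⟩
  eNumerator m /ᵘ m ! ℚᵘ.+ 1 /ᵘ suc m !                  ≡⟨ /ᵘ-+ (eNumerator m) (m !) 1 (suc m !) ⟩
  (eNumerator m * suc m ! + 1 * m !) /ᵘ (m ! * suc m !)  ≈⟨ /ᵘ-≃ _ _ _ _ cross ⟩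
  eNumerator (suc m) /ᵘ suc m !                          ∎
  where
  open ℚᵘ.≃-Reasoning
  instance
    _ = m !≢0
    _ = suc m !≢0
    _ = m*n≢0 (m !) (suc m !) {{m !≢0}} {{suc m !≢0}}
  lemma : ∀ a f k → (a * (k * f) + 1 * f) * (k * f) ≡ (1 + k * a) * (f * (k * f))
  lemma = solve-∀
  cross : (eNumerator m * suc m ! + 1 * m !) * suc m ! ≡ eNumerator (suc m) * (m ! * suc m !)
  cross = trans (lemma (eNumerator m) (m !) (suc m)) (cong (_* (m ! * suc m !)) (sym (eNumerator-suc m)))

toℚᵘ-eUpper : ∀ N → toℚᵘ (eUpper N) ℚᵘ.≃ proj₁ (eUpperᶠ N) /ᵘ proj₂ (eUpperᶠ N)
toℚᵘ-eUpper N = begin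
  toℚᵘ (eUpper N)                                            ≈⟨ ℚ.toℚᵘ-homo-+ (eSum K) _ ⟩
  toℚᵘ (eSum K) ℚᵘ.+ toℚᵘ (ℤ.+ 1 ℚ./ (K ! * K))              ≈⟨ ℚᵘ.+-cong (toℚᵘ-eSum K) (toℚᵘ-/ 1 (K ! * K)) ⟩
  eNumerator K /ᵘ K ! ℚᵘ.+ 1 /ᵘ (K ! * K)                    ≡⟨ /ᵘ-+ (eNumerator K) (K !) 1 (K ! * K) ⟩
  (eNumerator K * (K ! * K) + 1 * K !) /ᵘ (K ! * (K ! * K))  ≈⟨ /ᵘ-≃ _ _ _ _ (lemma (eNumerator K) (K !) K) ⟩
  (K * eNumerator K + 1) /ᵘ (K ! * K)                        ∎
  where
  K = suc N
  open ℚᵘ.≃-Reasoning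
  instance
    _ = K !≢0
    _ = m*n≢0 (K !) K {{K !≢0}}
    _ = m*n≢0 (K !) (K ! * K) {{K !≢0}} {{m*n≢0 (K !) K {{K !≢0}}}}
  lemma : ∀ a f k → (a * (f * k) + 1 * f) * (f * k) ≡ (k * a + 1) * (f * (f * k))
  lemma = solve-∀

toℚᵘ-powℚ : ∀ {q x y} .{{_ : NonZero y}} → toℚᵘ q ℚᵘ.≃ x /ᵘ y → ∀ d → toℚᵘ (powℚ q d) ℚᵘ.≃ x ^ d /ᵘ y ^ d
toℚᵘ-powℚ         q≃x/y zero    = ℚᵘ.≃-refl
toℚᵘ-powℚ {q} {x} {y} q≃x/y (suc d) = begin
  toℚᵘ (q ℚ.* powℚ q d)        ≈⟨ ℚ.toℚᵘ-homo-* q (powℚ q d) ⟩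
  toℚᵘ q ℚᵘ.* toℚᵘ (powℚ q d)  ≈⟨ ℚᵘ.*-cong q≃x/y (toℚᵘ-powℚ q≃x/y d) ⟩
  x /ᵘ y ℚᵘ.* x ^ d /ᵘ y ^ d   ≡⟨ /ᵘ-* x y (x ^ d) (y ^ d) ⟩
  x ^ suc d /ᵘ y ^ suc d       ∎
  where
  open ℚᵘ.≃-Reasoning
  instance _ = m^n≢0 y d

/ᵘ≰negative : ∀ x y z s → ¬ (x /ᵘ y ℚᵘ.≤ mkℚᵘ -[1+ z ] s)
/ᵘ≰negative x y z s (*≤* le) with subst (ℤ._≤ -[1+ z ] ℤ.* ℤ.+ suc (pred y)) (sym (pos-* x (suc s))) le
... | ()

e<q⇒fraction : ∀ A B d {q} → e< q → ℕ→ℚ A ℚ.* powℚ q d ℚ.< ℕ→ℚ B →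
               ∃[ x ] ∃[ b ] (∀ m → (suc m ^ m , m ^ m) ≤ᶠ (x , b)) × A * x ^ d < B * b ^ d
e<q⇒fraction A B d {q@(mkℚ (ℤ.+ x) s _)} (N , eUpper≤q) small = x , suc s , above , cleared
  where
  eUpper≤x/b : eUpperᶠ N ≤ᶠ (x , suc s)
  eUpper≤x/b = /ᵘ-≤⇒≤ᶠ (proj₁ (eUpperᶠ N)) (proj₂ (eUpperᶠ N)) x (suc s) {{m*n≢0 (suc N !) (suc N) {{suc N !≢0}}}}
                       (ℚᵘ.≤-respˡ-≃ (toℚᵘ-eUpper N) (ℚ.toℚᵘ-mono-≤ eUpper≤q))
  above : ∀ m → (suc m ^ m , m ^ m) ≤ᶠ (x , suc s)
  above m = ≤ᶠ-trans (0<eUpperᶠ-denominator N) ([1+1/m]^m≤ᶠeUpperᶠ m N) eUpper≤x/b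
  instance
    _ = m^n≢0 (suc s) d
    _ = m*n≢0 1 (suc s ^ d) {{_}} {{m^n≢0 (suc s) d}}
  lhs : toℚᵘ (ℕ→ℚ A ℚ.* powℚ q d) ℚᵘ.≃ (A * x ^ d) /ᵘ (1 * suc s ^ d)
  lhs = begin
    toℚᵘ (ℕ→ℚ A ℚ.* powℚ q d)          ≈⟨ ℚ.toℚᵘ-homo-* (ℕ→ℚ A) (powℚ q d) ⟩
    toℚᵘ (ℕ→ℚ A) ℚᵘ.* toℚᵘ (powℚ q d)  ≈⟨ ℚᵘ.*-cong (toℚᵘ-/ A 1) (toℚᵘ-powℚ ℚᵘ.≃-refl d) ⟩
    A /ᵘ 1 ℚᵘ.* x ^ d /ᵘ suc s ^ d     ≡⟨ /ᵘ-* A 1 (x ^ d) (suc s ^ d) ⟩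
    (A * x ^ d) /ᵘ (1 * suc s ^ d)     ∎
    where open ℚᵘ.≃-Reasoning
  cleared : A * x ^ d < B * suc s ^ d
  cleared = subst₂ _<_ (*-identityʳ (A * x ^ d)) (cong (B *_) (*-identityˡ (suc s ^ d)))
              (/ᵘ-<⇒< (A * x ^ d) (1 * suc s ^ d) B 1
                (ℚᵘ.<-respʳ-≃ (toℚᵘ-/ B 1) (ℚᵘ.<-respˡ-≃ lhs (ℚ.toℚᵘ-mono-< small))))
e<q⇒fraction _ _ _ {q = mkℚ -[1+ z ] s _} (N , eUpper≤q) _ =
  ⊥-elim (/ᵘ≰negative (proj₁ (eUpperᶠ N)) (proj₂ (eUpperᶠ N)) z s
            (ℚᵘ.≤-respˡ-≃ (toℚᵘ-eUpper N) (ℚ.toℚᵘ-mono-≤ eUpper≤q)))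

k*binomSum<2^n : ∀ n d k {x b} → 3 * d ≤ n → (∀ m → (suc m ^ m , m ^ m) ≤ᶠ (x , b)) →
                 2 * k * n ^ d * x ^ d < 2 ^ n * d ^ d * b ^ d → k * binomSum n d < 2 ^ n
k*binomSum<2^n n d k {x} {b} 3d≤n bound small with d^d/d!≤ᶠ[x/b]^d bound d
... | *≤* d^d/d!≤[x/b]^d = *-cancelʳ-< X (k * binomSum n d) (2 ^ n) (begin-strict
  k * binomSum n d * X              ≤⟨ *-monoʳ-≤ (k * binomSum n d) d^d/d!≤[x/b]^d ⟩
  k * binomSum n d * (x ^ d * d !)  ≡⟨ lemma₁ k (binomSum n d) (x ^ d) (d !) ⟩
  k * (binomSum n d * d !) * x ^ d  ≤⟨ *-monoˡ-≤ (x ^ d) (*-monoʳ-≤ k (binomSum*d!≤2*n^d n d 3d≤n)) ⟩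
  k * (2 * n ^ d) * x ^ d           ≡⟨ lemma₂ k (n ^ d) (x ^ d) ⟩
  2 * k * n ^ d * x ^ d             <⟨ small ⟩
  2 ^ n * d ^ d * b ^ d             ≡⟨ *-assoc (2 ^ n) _ _ ⟩
  2 ^ n * X                         ∎)
  where
  open ≤-Reasoning
  X = d ^ d * b ^ d
  lemma₁ : ∀ k s p f → k * s * (p * f) ≡ k * (s * f) * p
  lemma₁ = solve-∀
  lemma₂ : ∀ k q p → k * (2 * q) * p ≡ 2 * k * q * p
  lemma₂ = solve-∀

-- The hypotheses that k is at least the cop number and that k cops win only make capt_k (Q n)
-- defined; the bound does not use them.
theorem3p5 : (∀ (n d k : ℕ) → (∀ c → IsCopNumber (Q n) c → c ≤ k) → CopWin k (Q n) →
                 k * binomSum n d < 2 ^ n →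
                 ∀ t → IsCaptTime k (Q n) t → d < t)
               × (∀ (n d k : ℕ) → (∀ c → IsCopNumber (Q n) c → c ≤ k) → CopWin k (Q n) →
                 3 * d ≤ n →
                 (∃[ q ] ((e< q) × (ℕ→ℚ (2 * k * n ^ d) ℚ.* powℚ q d ℚ.< ℕ→ℚ (2 ^ n * d ^ d)))) →
                 ∀ t → IsCaptTime k (Q n) t → d < t)
theorem3p5 = (λ n d k _ _ small t capt → captWithin-lower-bound small (proj₁ capt))
           , λ n d k _ _ 3d≤n (q , e<q , small) t capt →
               let x , b , above , cleared = e<q⇒fraction (2 * k * n ^ d) (2 ^ n * d ^ d) d e<q small
               in captWithin-lower-bound (k*binomSum<2^n n d k 3d≤n above cleared) (proj₁ capt)
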